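{- In the setting below, let $R/\!\equiv$ be the set of $\equiv$-equivalence classes of rotor configurations. For every particle configuration $\sigma$, the map $[\rho]\mapsto[\sigma\rho]$ is a well-defined permutation of $R/\!\equiv$. Consequently the action of the sandpile monoid on rotor configurations induces an action $S(G/T)\times R/\!\equiv\ \to R/\!\equiv$ of the sandpile group on equivalence classes of rotor configurations.
   Context: $G=(V,E)$ is a finite strongly connected directed graph, $T\subseteq V$ a nonempty set of targets, $V_0=V\setminus T$, $d(v)$ the out-degree. At each $v\in V_0$ a rotor mechanism is fixed: an ordering $e_v^1,\dots,e_v^{d(v)}$ of the arcs leaving $v$, extended periodically; for $e=e_v^i$ put $e^+=e_v^{i+1}$. A rotor configuration is a map $\rho:V_0\to E$ with $\rho(v)$ an arc leaving $v$. A particle at $v\in V_0$ steps by replacing $\rho(v)$ with $\rho(v)^+$ and moving along the new $\rho(v)$; particles stop on reaching $T$. A particle configuration is a map $\sigma:V_0\to\mathbb{N}$; $\sigma\rho$ is the rotor configuration obtained by placing $\sigma(v)$ particles at each $v$ and letting all step until each reaches $T$ (independent of order). $\sigma$ is stable if $\sigma(v)\le d(v)-1$ for all $v$; toppling an unstable $v$ sends one particle along each arc leaving $v$ (particles reaching $T$ disappear), and repeated toppling gives a stable $\sigma^\circ$ independent of order; one has $\sigma^\circ\rho=\sigma\rho$. The sandpile monoid is the set of stable configurations with $(\sigma_1,\sigma_2)\mapsto(\sigma_1+\sigma_2)^\circ$; a stable $\tau$ is recurrent if for every $\sigma$ there is $\tau'$ with $\tau=(\tau'+\sigma)^\circ$;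 the recurrent configurations form an abelian group $S(G/T)$ (sandpile group). $\rho\equiv\rho'$ means $\sigma\rho=\sigma\rho'$ for some particle configuration $\sigma$; $[\rho]$ denotes the class of $\rho$. -}

module Defs where

open import Data.Nat using (ℕ; zero; suc; _+_; _*_; _∸_; _≤_; _<?_)
open import Data.Nat.Properties using ()
open import Data.Fin using (Fin; zero; suc; toℕ; fromℕ<; _≟_)
open import Data.Bool using (Bool; true; false)
open import Data.List using (List; map; allFin)
open import Data.Nat.ListAction using (sum)
open import Data.Product using (Σ; ∃; _×_; _,_; proj₁; proj₂)
open import Relation.Nullary using (yes; no)
open import Relation.Binary.PropositionalEquality using (_≡_; refl)

-- The arcs leaving v are e_v^1 … e_v^{d v},
-- indexed by Fin (d v) in rotor order; `head v i` is the head of the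
-- arc with index i.

record RotorGraph : Set where
  field
    n    : ℕ
    d    : Fin n → ℕ
    head : (v : Fin n) → Fin (d v) → Fin n
    T    : Fin n → Bool

sucMod : ∀ {m} → Fin m → Fin m
sucMod {suc m} i with suc (toℕ i) <? suc m
... | yes p = fromℕ< p
... | no _  = zero

module _ (G : RotorGraph) where
  open RotorGraph G

  data Reach : Fin n → Fin n → Set where
    here  : ∀ {u} → Reach u u
    there : ∀ {u w} (i : Fin (d u)) → Reach (head u i) w → Reach u w

  StronglyConnected : Set
  StronglyConnected = ∀ u w → Reach u w

  NonemptyTargets : Set
  NonemptyTargets = ∃ λ v → T v ≡ true

  V₀ : Set
  V₀ = Σ (Fin n) (λ v → T v ≡ false)

  RConf : Set
  RConf = (x : V₀) → Fin (d (proj₁ x))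

  _≈_ : RConf → RConf → Set
  ρ ≈ ρ' = ∀ x → ρ x ≡ ρ' x

  PConf : Set
  PConf = V₀ → ℕ

  _⊕_ : PConf → PConf → PConf
  (σ ⊕ τ) x = σ x + τ x

  upd : RConf → (x : V₀) → Fin (d (proj₁ x)) → RConf
  upd ρ (v , p) i (w , q) with w ≟ v
  ... | yes refl = i
  ... | no _     = ρ (w , q)

  δ : Fin n → V₀ → ℕ
  δ w (y , _) with y ≟ w
  ... | yes _ = 1
  ... | no _  = 0

  -- one particle at x = (v , p) steps: its rotor advances to ρ(v)⁺ and
  -- the particle moves along the new rotor arc (disappearing if it
  -- lands in T, since δ w vanishes on V₀ when w ∈ T).
  newRotor : RConf → (x : V₀) → Fin (d (proj₁ x))
  newRotor ρ x = sucMod (ρ x)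

  stepP : PConf → RConf → V₀ → PConf
  stepP σ ρ x y = (σ y ∸ δ (proj₁ x) y) + δ (head (proj₁ x) (newRotor ρ x)) y

  stepR : RConf → V₀ → RConf
  stepR ρ x = upd ρ x (newRotor ρ x)

  -- Act σ ρ ρ' : placing σ on ρ and letting all particles step (in some
  -- order) until every particle has reached T yields rotor config ρ'
  -- (i.e. ρ' = σρ).
  data Act : PConf → RConf → RConf → Set where
    done : ∀ {σ ρ ρ'} → (∀ x → σ x ≡ 0) → ρ ≈ ρ' → Act σ ρ ρ'
    step : ∀ {σ ρ ρ'} (x : V₀) → 1 ≤ σ x →
           Act (stepP σ ρ x) (stepR ρ x) ρ' → Act σ ρ ρ'

  _∼_ : RConf → RConf → Set
  ρ ∼ ρ' = ∃ λ σ → ∃ λ ρ₁ → ∃ λ ρ₂ → Act σ ρ ρ₁ × Act σ ρ' ρ₂ × ρ₁ ≈ ρ₂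

  Stable : PConf → Set
  Stable σ = ∀ x → suc (σ x) ≤ d (proj₁ x)

  arcsTo : Fin n → V₀ → ℕ
  arcsTo v y = sum (map (λ i → δ (head v i) y) (allFin (d v)))

  toppleAt : PConf → V₀ → PConf
  toppleAt σ x y = (σ y ∸ (δ (proj₁ x) y * d (proj₁ x))) + arcsTo (proj₁ x) y

  data Stab : PConf → PConf → Set where
    done   : ∀ {σ τ} → Stable σ → (∀ x → σ x ≡ τ x) → Stab σ τ
    topple : ∀ {σ τ} (x : V₀) → d (proj₁ x) ≤ σ x →
             Stab (toppleAt σ x) τ → Stab σ τ

  Recurrent : PConf → Set
  Recurrent τ = Stable τ × (∀ σ → ∃ λ τ' → Stable τ' × Stab (τ' ⊕ σ) τ)

module Submission where

-- Rotor walks are abelian: firing order is irrelevant, so σρ is well defined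
-- and (σ + ω)ρ = ω(σρ).  Hence [ρ] ↦ [σρ] respects ≡ (σ and ω commute) and
-- reflects it (if ω witnesses σρ ≡ σρ′ then σ + ω witnesses ρ ≡ ρ′); it is
-- onto because its iterates on any ρ′ repeat, there being finitely many rotor
-- configurations.  Firing d(v) particles at v turns the rotor at v once round
-- and sends one particle along each arc, i.e. topples v, so σρ = σ°ρ; this
-- carries the group law of S(G/T) to composition of the actions.  Finally every
-- particle reaches T: strong connectivity gives, for any S ⊇ T not containing
-- the particle, an arc from some w ∉ S into S, and walks to S ∪ {w} are
-- extended to walks to S by letting the rotor at w turn.

open import Defs
open import Axiom.UniquenessOfIdentityProofs using (module Decidable⇒UIP)
open import Data.Bool using (Bool; true; false)
import Data.Bool.Properties as Bool
open import Data.Fin using (Fin; zero; suc; toℕ; fromℕ; _≟_; combine)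
open import Data.Fin.Properties
  using (toℕ-fromℕ; toℕ-fromℕ<; toℕ-injective; toℕ<n; suc-injective; combine-injectiveˡ; combine-injectiveʳ; pigeonhole)
open import Data.Fin.Subset using (Subset; _∈_; _∉_; _⊆_; _⊃_; _∪_; ⁅_⁆)
open import Data.Fin.Subset.Properties using (_∈?_; p⊆p∪q; q⊆p∪q; x∈p∪q⁻; x∈⁅x⁆; x∈⁅y⁆⇒x≡y)
open import Data.Fin.Subset.Induction using (Acc; acc; ⊃-wellFounded)
open import Data.List using (List; []; _∷_; map; allFin; tabulate)
open import Data.List.Membership.Propositional using () renaming (_∈_ to _∈ₗ_; _∉_ to _∉ₗ_)
open import Data.List.Membership.Propositional.Properties using (∈-allFin)
open import Data.List.Properties using (tabulate-cong; map-tabulate)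
open import Data.List.Relation.Unary.Any using (here; there)
open import Data.Nat using (ℕ; zero; suc; _+_; _*_; _∸_; _≤_; _<_; z≤n; s≤s; _<?_)
open import Data.Nat.GeneralisedArithmetic using (iterate; iterate-is-fold)
open import Data.Nat.ListAction using (sum; product)
open import Data.Nat.Properties
  using (+-commutativeSemigroup; +-comm; +-assoc; +-suc; +-identityʳ; *-identityˡ; *-zeroʳ; +-∸-comm; n∸n≡0; 0∸n≡0; m∸n+n≡m; m+[n∸m]≡n;
         m≤m+n; ∸-monoˡ-≤; ≤-refl; ≤-reflexive; ≤-trans; ≤-<-trans; ≤-pred; <-irrefl; n≮0; n<1+n)
open import Algebra.Properties.CommutativeSemigroup +-commutativeSemigroup using (xy∙z≈xz∙y)
open import Data.Product using (Σ; ∃; ∃₂; _×_; _,_; proj₁; proj₂)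
open import Data.Sum using (inj₁; inj₂)
import Data.Vec as Vec
open import Data.Vec.Properties using ([]=⇒lookup; lookup⇒[]=; lookup∘tabulate)
open import Function using (_∘_; id)
open import Relation.Binary.PropositionalEquality
open import Relation.Nullary using (Dec; yes; no; ¬_; contradiction)
open import Relation.Nullary.Decidable using (map′)
open ≡-Reasoning

iterate-+ : ∀ {a} {A : Set a} (f : A → A) (x : A) m k →
            iterate f x (m + k) ≡ iterate f (iterate f x m) k
iterate-+ f x zero    k = refl
iterate-+ f x (suc m) k = iterate-+ f (f x) m k

iterate-suc : ∀ {a} {A : Set a} (f : A → A) (x : A) k → iterate f x (suc k) ≡ f (iterate f x k)
iterate-suc f x k = trans (sym (iterate-is-fold x f (suc k))) (cong f (iterate-is-fold x f k))

iterate-pigeonhole : ∀ {a} {A : Set a} {N} (f : A → A) (code : A → Fin N) (x : A) →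
                     ∃₂ λ m k → code (iterate f (f (iterate f x k)) m) ≡ code (iterate f x m)
iterate-pigeonhole {N = N} f code x =
  let i , j , i<j , coincide = pigeonhole (n<1+n N) (λ l → code (iterate f x (toℕ l)))
      m = toℕ i
      k = toℕ j ∸ suc m
  in m , k , (begin
    code (iterate f (f (iterate f x k)) m)  ≡⟨ cong (λ y → code (iterate f y m)) (sym (iterate-suc f x k)) ⟩
    code (iterate f (iterate f x (suc k)) m) ≡⟨ cong code (sym (iterate-+ f x (suc k) m)) ⟩
    code (iterate f x (suc k + m))           ≡⟨ cong (code ∘ iterate f x) (trans (sym (+-suc k m)) (m∸n+n≡m i<j)) ⟩
    code (iterate f x (toℕ j))               ≡⟨ sym coincide ⟩
    code (iterate f x m)                     ∎)

rotate : ∀ {m} → ℕ → Fin m → Fin m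
rotate k r = iterate sucMod r k

toℕ-sucMod : ∀ {m} (r : Fin m) → suc (toℕ r) < m → toℕ (sucMod r) ≡ suc (toℕ r)
toℕ-sucMod {suc m} r r+1<m with suc (toℕ r) <? suc m
... | yes p = toℕ-fromℕ< p
... | no  ¬p = contradiction r+1<m ¬p

sucMod-last : ∀ {m} (r : Fin (suc m)) → toℕ r ≡ m → sucMod r ≡ zero
sucMod-last {m} r r≡m with suc (toℕ r) <? suc m
... | yes p = contradiction p (<-irrefl (cong suc r≡m))
... | no  _ = refl

toℕ-rotate : ∀ {m} k (r : Fin m) → toℕ r + k < m → toℕ (rotate k r) ≡ toℕ r + k
toℕ-rotate zero    r _ = sym (+-identityʳ (toℕ r))
toℕ-rotate {m} (suc k) r r+k<m = begin
  toℕ (rotate k (sucMod r)) ≡⟨ toℕ-rotate k (sucMod r) (subst (λ l → l + k < m) (sym toℕ-next) r+1+k<m) ⟩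
  toℕ (sucMod r) + k        ≡⟨ cong (_+ k) toℕ-next ⟩
  suc (toℕ r) + k           ≡⟨ sym (+-suc (toℕ r) k) ⟩
  toℕ r + suc k             ∎
  where
  r+1+k<m : suc (toℕ r + k) < m
  r+1+k<m = subst (_< m) (+-suc (toℕ r) k) r+k<m
  toℕ-next : toℕ (sucMod r) ≡ suc (toℕ r)
  toℕ-next = toℕ-sucMod r (≤-<-trans (s≤s (m≤m+n (toℕ r) k)) r+1+k<m)

rotate-zero : ∀ {m} (i : Fin (suc m)) → rotate (toℕ i) zero ≡ i
rotate-zero i = toℕ-injective (toℕ-rotate (toℕ i) zero (toℕ<n i))

rotate-wrap : ∀ {m} (r : Fin (suc m)) → rotate (suc (m ∸ toℕ r)) r ≡ zero
rotate-wrap {m} r = begin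
  rotate (suc k) r    ≡⟨ cong (λ l → rotate l r) (+-comm 1 k) ⟩
  rotate (k + 1) r    ≡⟨ iterate-+ sucMod r k 1 ⟩
  sucMod (rotate k r) ≡⟨ sucMod-last (rotate k r) (trans (toℕ-rotate k r (s≤s (≤-reflexive r+k≡m))) r+k≡m) ⟩
  zero                ∎
  where
  k : ℕ
  k = m ∸ toℕ r
  r+k≡m : toℕ r + k ≡ m
  r+k≡m = m+[n∸m]≡n (≤-pred (toℕ<n r))

rotate-through-zero : ∀ {m} (r i : Fin (suc m)) → rotate (suc (m ∸ toℕ r) + toℕ i) r ≡ i
rotate-through-zero {m} r i = begin
  rotate (suc (m ∸ toℕ r) + toℕ i) r          ≡⟨ iterate-+ sucMod r (suc (m ∸ toℕ r)) (toℕ i) ⟩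
  rotate (toℕ i) (rotate (suc (m ∸ toℕ r)) r) ≡⟨ cong (rotate (toℕ i)) (rotate-wrap r) ⟩
  rotate (toℕ i) zero                         ≡⟨ rotate-zero i ⟩
  i                                           ∎

rotate-surjective : ∀ {m} (r i : Fin m) → ∃ λ k → rotate k r ≡ i
rotate-surjective {suc m} r i = suc (m ∸ toℕ r) + toℕ i , rotate-through-zero r i

rotate-period : ∀ {m} (r : Fin m) → rotate m r ≡ r
rotate-period {suc m} r =
  subst (λ k → rotate k r ≡ r) (cong suc (m∸n+n≡m (≤-pred (toℕ<n r)))) (rotate-through-zero r r)

rotationSum : ∀ {m} → (Fin m → ℕ) → ℕ → Fin m → ℕ
rotationSum f zero    r = 0
rotationSum f (suc k) r = f (sucMod r) + rotationSum f k (sucMod r)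

rotationSum-snoc : ∀ {m} (f : Fin m → ℕ) k r →
                   rotationSum f (suc k) r ≡ rotationSum f k r + f (rotate (suc k) r)
rotationSum-snoc f zero    r = +-comm (f (sucMod r)) 0
rotationSum-snoc f (suc k) r =
  trans (cong (f (sucMod r) +_) (rotationSum-snoc f k (sucMod r))) (sym (+-assoc (f (sucMod r)) _ _))

rotationSum-sucMod : ∀ {m} (f : Fin m → ℕ) r → rotationSum f m (sucMod r) ≡ rotationSum f m r
rotationSum-sucMod {suc m} f r = begin
  rotationSum f (suc m) (sucMod r)                          ≡⟨ rotationSum-snoc f m (sucMod r) ⟩
  rotationSum f m (sucMod r) + f (rotate (suc m) (sucMod r)) ≡⟨ cong (λ i → rotationSum f m (sucMod r) + f i) (rotate-period (sucMod r)) ⟩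
  rotationSum f m (sucMod r) + f (sucMod r)                 ≡⟨ +-comm _ (f (sucMod r)) ⟩
  rotationSum f (suc m) r                                   ∎

rotationSum-rotate : ∀ {m} (f : Fin m → ℕ) k r → rotationSum f m (rotate k r) ≡ rotationSum f m r
rotationSum-rotate f zero    r = refl
rotationSum-rotate f (suc k) r = trans (rotationSum-rotate f k (sucMod r)) (rotationSum-sucMod f r)

rotationSum-tabulate : ∀ {m} (f : Fin m → ℕ) k r →
                       rotationSum f k r ≡ sum (tabulate {n = k} (λ j → f (rotate (toℕ j) (sucMod r))))
rotationSum-tabulate f zero    r = refl
rotationSum-tabulate f (suc k) r = cong (f (sucMod r) +_) (rotationSum-tabulate f k (sucMod r))

rotationSum-full : ∀ {m} (f : Fin m → ℕ) r → rotationSum f m r ≡ sum (map f (allFin m))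
rotationSum-full {suc m} f r = begin
  rotationSum f (suc m) r          ≡⟨ sym (rotationSum-rotate f k r) ⟩
  rotationSum f (suc m) (rotate k r) ≡⟨ cong (rotationSum f (suc m)) reaches-last ⟩
  rotationSum f (suc m) (fromℕ m)  ≡⟨ rotationSum-tabulate f (suc m) (fromℕ m) ⟩
  sum (tabulate {n = suc m} (λ j → f (rotate (toℕ j) (sucMod (fromℕ m))))) ≡⟨ cong sum (tabulate-cong {n = suc m} from-zero) ⟩
  sum (tabulate f)                 ≡⟨ cong sum (sym (map-tabulate id f)) ⟩
  sum (map f (allFin (suc m)))     ∎
  where
  k : ℕ
  k = proj₁ (rotate-surjective r (fromℕ m))
  reaches-last : rotate k r ≡ fromℕ m
  reaches-last = proj₂ (rotate-surjective r (fromℕ m))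
  from-zero : ∀ j → f (rotate (toℕ j) (sucMod (fromℕ m))) ≡ f j
  from-zero j = cong f (trans (cong (rotate (toℕ j)) (sucMod-last (fromℕ m) (toℕ-fromℕ m))) (rotate-zero j))

module RotorDynamics (G : RotorGraph) where
  open RotorGraph G

  infix 4 _≈ᴳ_ _∼ᴳ_
  _≈ᴳ_ _∼ᴳ_ : RConf G → RConf G → Set
  _≈ᴳ_ = _≈_ G
  _∼ᴳ_ = _∼_ G

  private variable
    σ σ′ τ ω : PConf G
    ρ ρ′ a a′ b c : RConf G

  ≈-refl : ρ ≈ᴳ ρ
  ≈-refl _ = refl

  ≈-sym : ρ ≈ᴳ ρ′ → ρ′ ≈ᴳ ρ
  ≈-sym ρ≈ρ′ x = sym (ρ≈ρ′ x)

  ≈-trans : ρ ≈ᴳ ρ′ → ρ′ ≈ᴳ a → ρ ≈ᴳ a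
  ≈-trans ρ≈ρ′ ρ′≈a x = trans (ρ≈ρ′ x) (ρ′≈a x)

  V₀-irrelevant : ∀ {v} (p q : T v ≡ false) → p ≡ q
  V₀-irrelevant = Decidable⇒UIP.≡-irrelevant Bool._≟_

  ≡-fromVertex : {x y : V₀ G} → proj₁ x ≡ proj₁ y → x ≡ y
  ≡-fromVertex {v , p} {.v , q} refl = cong (v ,_) (V₀-irrelevant p q)

  _≟₀_ : (x y : V₀ G) → Dec (x ≡ y)
  x ≟₀ y = map′ ≡-fromVertex (cong proj₁) (proj₁ x ≟ proj₁ y)

  vertex-≢ : {x y : V₀ G} → x ≢ y → proj₁ x ≢ proj₁ y
  vertex-≢ x≢y = x≢y ∘ ≡-fromVertex

  δ-self : (x : V₀ G) → δ G (proj₁ x) x ≡ 1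
  δ-self (v , _) with v ≟ v
  ... | yes _   = refl
  ... | no  v≢v = contradiction refl v≢v

  δ-≢ : ∀ {w} (y : V₀ G) → proj₁ y ≢ w → δ G w y ≡ 0
  δ-≢ {w} (v , _) v≢w with v ≟ w
  ... | yes v≡w = contradiction v≡w v≢w
  ... | no  _   = refl

  δ-other : {x : V₀ G} (y : V₀ G) → y ≢ x → δ G (proj₁ x) y ≡ 0
  δ-other y y≢x = δ-≢ y (vertex-≢ y≢x)

  V₀-≢-target : ∀ {w} → T w ≡ true → (y : V₀ G) → proj₁ y ≢ w
  V₀-≢-target tw y y≡w = contradiction (trans (sym (proj₂ y)) (trans (cong T y≡w) tw)) λ ()

  δ-target : ∀ {w} → T w ≡ true → (y : V₀ G) → δ G w y ≡ 0
  δ-target tw y = δ-≢ y (V₀-≢-target tw y)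

  δ≤1 : ∀ w (y : V₀ G) → δ G w y ≤ 1
  δ≤1 w (v , _) with v ≟ w
  ... | yes _ = ≤-refl
  ... | no  _ = z≤n

  δ≤occupied : (x : V₀ G) → 1 ≤ σ x → (y : V₀ G) → δ G (proj₁ x) y ≤ σ y
  δ≤occupied x occupied y with y ≟₀ x
  ... | yes refl = ≤-trans (≤-reflexive (δ-self y)) occupied
  ... | no  y≢x  = subst (_≤ _) (sym (δ-other y y≢x)) z≤n

  δ-disjoint : {x y : V₀ G} → x ≢ y → (z : V₀ G) → δ G (proj₁ x) z + δ G (proj₁ y) z ≤ 1
  δ-disjoint {x} {y} x≢y z with z ≟₀ x
  ... | yes refl rewrite δ-self z | δ-other z x≢y = ≤-refl
  ... | no  z≢x  rewrite δ-other z z≢x = δ≤1 (proj₁ y) z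

  upd-≡ : (ρ : RConf G) (x : V₀ G) (i : Fin (d (proj₁ x))) → upd G ρ x i x ≡ i
  upd-≡ ρ (v , _) i with v ≟ v
  ... | yes refl = refl
  ... | no  v≢v  = contradiction refl v≢v

  upd-≢ : (ρ : RConf G) (x : V₀ G) (i : Fin (d (proj₁ x))) (y : V₀ G) → y ≢ x → upd G ρ x i y ≡ ρ y
  upd-≢ ρ (v , _) i (w , _) y≢x with w ≟ v
  ... | yes w≡v = contradiction (≡-fromVertex w≡v) y≢x
  ... | no  _   = refl

  upd-cong : (x : V₀ G) {i j : Fin (d (proj₁ x))} → ρ ≈ᴳ ρ′ → i ≡ j → upd G ρ x i ≈ᴳ upd G ρ′ x j
  upd-cong {ρ} {ρ′} x {i} {j} ρ≈ρ′ i≡j z with z ≟₀ x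
  ... | yes refl = trans (upd-≡ ρ z i) (trans i≡j (sym (upd-≡ ρ′ z j)))
  ... | no  z≢x  = trans (upd-≢ ρ x i z z≢x) (trans (ρ≈ρ′ z) (sym (upd-≢ ρ′ x j z z≢x)))

  upd-upd : (ρ : RConf G) (x : V₀ G) (i j : Fin (d (proj₁ x))) → upd G (upd G ρ x i) x j ≈ᴳ upd G ρ x j
  upd-upd ρ x i j z with z ≟₀ x
  ... | yes refl = trans (upd-≡ _ z j) (sym (upd-≡ ρ z j))
  ... | no  z≢x  = trans (upd-≢ _ x j z z≢x) (trans (upd-≢ ρ x i z z≢x) (sym (upd-≢ ρ x j z z≢x)))

  upd-self : (ρ : RConf G) (x : V₀ G) → upd G ρ x (ρ x) ≈ᴳ ρ
  upd-self ρ x z with z ≟₀ x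
  ... | yes refl = upd-≡ ρ z (ρ z)
  ... | no  z≢x  = upd-≢ ρ x (ρ x) z z≢x

  upd-comm : (ρ : RConf G) {x y : V₀ G} (i : Fin (d (proj₁ x))) (j : Fin (d (proj₁ y))) → x ≢ y → upd G (upd G ρ y j) x i ≈ᴳ upd G (upd G ρ x i) y j
  upd-comm ρ {x} {y} i j x≢y z with z ≟₀ x | z ≟₀ y
  ... | yes refl | _ = trans (upd-≡ _ z i) (sym (trans (upd-≢ _ y j z x≢y) (upd-≡ ρ z i)))
  ... | no  z≢x  | yes refl =
    trans (upd-≢ _ x i z z≢x) (trans (upd-≡ ρ z j) (sym (upd-≡ _ z j)))
  ... | no  z≢x  | no  z≢y  =
    trans (upd-≢ _ x i z z≢x) (trans (upd-≢ ρ y j z z≢y) (sym (trans (upd-≢ _ y j z z≢y) (upd-≢ ρ x i z z≢x))))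

  stepR-cong : (x : V₀ G) → ρ ≈ᴳ ρ′ → stepR G ρ x ≈ᴳ stepR G ρ′ x
  stepR-cong x ρ≈ρ′ = upd-cong x ρ≈ρ′ (cong sucMod (ρ≈ρ′ x))

  stepP-cong : (x : V₀ G) → σ ≗ σ′ → ρ ≈ᴳ ρ′ → stepP G σ ρ x ≗ stepP G σ′ ρ′ x
  stepP-cong x σ≗σ′ ρ≈ρ′ y =
    cong₂ _+_ (cong (_∸ δ G (proj₁ x) y) (σ≗σ′ y)) (cong (λ i → δ G (head (proj₁ x) (sucMod i)) y) (ρ≈ρ′ x))

  Act-resp : Act G σ ρ a → σ ≗ σ′ → ρ ≈ᴳ ρ′ → a ≈ᴳ a′ → Act G σ′ ρ′ a′
  Act-resp (done σ≗0 ρ≈a) σ≗σ′ ρ≈ρ′ a≈a′ =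
    done (λ x → trans (sym (σ≗σ′ x)) (σ≗0 x)) (≈-trans (≈-sym ρ≈ρ′) (≈-trans ρ≈a a≈a′))
  Act-resp (step x occupied D) σ≗σ′ ρ≈ρ′ a≈a′ =
    step x (subst (1 ≤_) (σ≗σ′ x) occupied) (Act-resp D (stepP-cong x σ≗σ′ ρ≈ρ′) (stepR-cong x ρ≈ρ′) a≈a′)

  ⊕-comm : (σ τ : PConf G) → _⊕_ G σ τ ≗ _⊕_ G τ σ
  ⊕-comm σ τ y = +-comm (σ y) (τ y)

  Act-⊕ : Act G σ ρ a → Act G τ a b → Act G (_⊕_ G σ τ) ρ b
  Act-⊕ {τ = τ} (done σ≗0 ρ≈a) E = Act-resp E (λ y → cong (_+ τ y) (sym (σ≗0 y))) (≈-sym ρ≈a) ≈-refl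
  Act-⊕ {σ} {τ = τ} (step x occupied D) E =
    step x (≤-trans occupied (m≤m+n (σ x) (τ x)))
      (Act-resp (Act-⊕ D E) (λ y → shift (σ y) (τ y) (δ≤occupied x occupied y)) ≈-refl ≈-refl)
    where
    shift : ∀ s t {e c} → e ≤ s → ((s ∸ e) + c) + t ≡ ((s + t) ∸ e) + c
    shift s t {e} {c} e≤s = trans (xy∙z≈xz∙y (s ∸ e) c t) (cong (_+ c) (sym (+-∸-comm t e≤s)))

  stepR-comm : (ρ : RConf G) {x y : V₀ G} → x ≢ y → stepR G (stepR G ρ y) x ≈ᴳ stepR G (stepR G ρ x) y
  stepR-comm ρ {x} {y} x≢y =
    ≈-trans (upd-cong x ≈-refl (cong sucMod (upd-≢ ρ y _ x x≢y)))
      (≈-trans (upd-comm ρ _ _ x≢y) (upd-cong y ≈-refl (cong sucMod (sym (upd-≢ ρ x _ y (x≢y ∘ sym))))))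

  stepP-comm : (x y : V₀ G) → x ≢ y → 1 ≤ σ x → 1 ≤ σ y →
               stepP G (stepP G σ ρ y) (stepR G ρ y) x ≗ stepP G (stepP G σ ρ x) (stepR G ρ x) y
  stepP-comm {σ} {ρ} x y x≢y x-occupied y-occupied z = begin
    ((σ z ∸ loss y z) + arrival y (ρ y) ∸ loss x z) + arrival x (stepR G ρ y x)
      ≡⟨ cong (λ i → ((σ z ∸ loss y z) + arrival y (ρ y) ∸ loss x z) + arrival x i) (upd-≢ ρ y _ x x≢y) ⟩
    ((σ z ∸ loss y z) + arrival y (ρ y) ∸ loss x z) + arrival x (ρ x)
      ≡⟨ swap (σ z) (δ-disjoint x≢y z) (δ≤occupied x x-occupied z) (δ≤occupied y y-occupied z) ⟩
    ((σ z ∸ loss x z) + arrival x (ρ x) ∸ loss y z) + arrival y (ρ y)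
      ≡⟨ cong (λ i → ((σ z ∸ loss x z) + arrival x (ρ x) ∸ loss y z) + arrival y i) (sym (upd-≢ ρ x _ y (x≢y ∘ sym))) ⟩
    ((σ z ∸ loss x z) + arrival x (ρ x) ∸ loss y z) + arrival y (stepR G ρ x y) ∎
    where
    loss : V₀ G → V₀ G → ℕ
    loss u = δ G (proj₁ u)
    arrival : (u : V₀ G) → Fin (d (proj₁ u)) → ℕ
    arrival u i = δ G (head (proj₁ u) (sucMod i)) z
    -- a vertex loses at most one of the two particles, since x ≠ y
    swap : ∀ s {e f p q} → e + f ≤ 1 → e ≤ s → f ≤ s → ((s ∸ f) + p ∸ e) + q ≡ ((s ∸ e) + q ∸ f) + p
    swap s {0} {0} {p} {q} _ _ _ = xy∙z≈xz∙y s p q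
    swap (suc s) {1} {0} {p} {q} _ _ _ = xy∙z≈xz∙y s p q
    swap (suc s) {0} {1} {p} {q} _ _ _ = xy∙z≈xz∙y s p q
    swap s {1} {suc _} (s≤s ())
    swap s {suc (suc _)} (s≤s ())
    swap s {0} {suc (suc _)} (s≤s ())

  empty-unoccupied : (∀ x → σ x ≡ 0) → (x : V₀ G) → ¬ (1 ≤ σ x)
  empty-unoccupied σ≗0 x occupied = n≮0 (subst (1 ≤_) (σ≗0 x) occupied)

  stepP-occupied : (x y : V₀ G) → y ≢ x → 1 ≤ σ y → 1 ≤ stepP G σ ρ x y
  stepP-occupied {σ} x y y≢x occupied rewrite δ-other y y≢x = ≤-trans occupied (m≤m+n (σ y) _)

  -- Local confluence, by commuting the first two firings.
  Act-fireFirst : Act G σ ρ a → (x : V₀ G) → 1 ≤ σ x → Act G (stepP G σ ρ x) (stepR G ρ x) a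
  Act-fireFirst (done σ≗0 _) x occupied = contradiction occupied (empty-unoccupied σ≗0 x)
  Act-fireFirst {σ} {ρ} (step y y-occupied D) x x-occupied with y ≟₀ x
  ... | yes refl = D
  ... | no  y≢x  =
    step y (stepP-occupied {σ = σ} {ρ = ρ} x y y≢x y-occupied)
      (Act-resp (Act-fireFirst D x (stepP-occupied {σ = σ} {ρ = ρ} y x (y≢x ∘ sym) x-occupied))
        (stepP-comm x y (y≢x ∘ sym) x-occupied y-occupied) (stepR-comm ρ (y≢x ∘ sym)) ≈-refl)

  Act-deterministic : Act G σ ρ a → Act G σ ρ b → a ≈ᴳ b
  Act-deterministic (done _ ρ≈a) (done _ ρ≈b) = ≈-trans (≈-sym ρ≈a) ρ≈b
  Act-deterministic (done σ≗0 _) (step y occupied _) = contradiction occupied (empty-unoccupied σ≗0 y)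
  Act-deterministic (step x occupied D) E = Act-deterministic D (Act-fireFirst E x occupied)

  Act-swap : Act G σ ρ a → Act G ω a b → Act G ω ρ a′ → Act G σ a′ c → b ≈ᴳ c
  Act-swap {σ} {ω = ω} Dσ Dω Eω Eσ =
    Act-deterministic (Act-resp (Act-⊕ Dσ Dω) (⊕-comm σ ω) ≈-refl ≈-refl) (Act-⊕ Eω Eσ)

  Act-fire : ∀ k (x : V₀ G) → k ≤ σ x → Act G σ ρ a →
             Act G (λ y → (σ y ∸ δ G (proj₁ x) y * k) + rotationSum (λ i → δ G (head (proj₁ x) i) y) k (ρ x))
                   (upd G ρ x (rotate k (ρ x))) a
  Act-fire {σ} {ρ} zero x _ D =
    Act-resp D (λ y → sym (trans (+-identityʳ _) (cong (σ y ∸_) (*-zeroʳ (δ G (proj₁ x) y)))))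
      (≈-sym (upd-self ρ x)) ≈-refl
  Act-fire {σ} {ρ} (suc k) x k<σx D =
    Act-resp (Act-fire k x k≤ (Act-fireFirst D x (≤-trans (s≤s z≤n) k<σx)))
      particles (≈-trans (upd-cong x ≈-refl (cong (rotate k) (upd-≡ ρ x _))) (upd-upd ρ x _ _)) ≈-refl
    where
    v : Fin n
    v = proj₁ x
    k≤ : k ≤ stepP G σ ρ x x
    k≤ rewrite δ-self x = ≤-trans (∸-monoˡ-≤ 1 k<σx) (m≤m+n (σ x ∸ 1) _)
    fired : ∀ s {a r} → suc k ≤ s → ((s ∸ 1) + a ∸ 1 * k) + r ≡ (s ∸ 1 * suc k) + (a + r)
    fired (suc s) {a} {r} (s≤s k≤s) = begin
      (s + a ∸ 1 * k) + r   ≡⟨ cong (λ l → (s + a ∸ l) + r) (*-identityˡ k) ⟩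
      (s + a ∸ k) + r       ≡⟨ cong (_+ r) (+-∸-comm a k≤s) ⟩
      (s ∸ k + a) + r       ≡⟨ +-assoc (s ∸ k) a r ⟩
      (s ∸ k) + (a + r)     ≡⟨ cong (λ l → (s ∸ l) + (a + r)) (sym (*-identityˡ k)) ⟩
      (s ∸ 1 * k) + (a + r) ∎
    particles : ∀ y → (stepP G σ ρ x y ∸ δ G v y * k) + rotationSum (λ i → δ G (head v i) y) k (stepR G ρ x x)
                    ≡ (σ y ∸ δ G v y * suc k) + rotationSum (λ i → δ G (head v i) y) (suc k) (ρ x)
    particles y rewrite upd-≡ ρ x (sucMod (ρ x)) with y ≟₀ x
    ... | yes refl rewrite δ-self y = fired (σ y) k<σx
    ... | no  y≢x  rewrite δ-other y y≢x = +-assoc (σ y) _ _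

  Act-topple : (x : V₀ G) → d (proj₁ x) ≤ σ x → Act G σ ρ a → Act G (toppleAt G σ x) ρ a
  Act-topple {σ} {ρ} x d≤σx D =
    Act-resp (Act-fire (d (proj₁ x)) x d≤σx D)
      (λ y → cong ((σ y ∸ δ G (proj₁ x) y * d (proj₁ x)) +_) (rotationSum-full _ (ρ x)))
      (≈-trans (upd-cong x ≈-refl (rotate-period (ρ x))) (upd-self ρ x)) ≈-refl

  Act-stabilise : Stab G σ τ → Act G σ ρ a → Act G τ ρ a
  Act-stabilise (done _ σ≗τ)       D = Act-resp D σ≗τ ≈-refl ≈-refl
  Act-stabilise (topple x d≤σx S) D = Act-stabilise S (Act-topple x d≤σx D)

  Act-⊕-stabilise : Stab G (_⊕_ G τ σ) ω → Act G σ ρ a → Act G τ a b → Act G ω ρ c → c ≈ᴳ b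
  Act-⊕-stabilise {τ} {σ} S Dσ Dτ Dω =
    Act-deterministic Dω (Act-stabilise S (Act-resp (Act-⊕ Dσ Dτ) (⊕-comm σ τ) ≈-refl ≈-refl))

  Act-idempotent : Stab G (_⊕_ G σ σ) σ → Act G σ ρ a → Act G σ a b → b ≈ᴳ a
  Act-idempotent S D E = Act-deterministic (Act-stabilise S (Act-⊕ D E)) D

  _·_ : ℕ → PConf G → PConf G
  (k · σ) y = k * σ y

  Act-iterate : {F : RConf G → RConf G} → (∀ ρ → Act G σ ρ (F ρ)) → ∀ k ρ → Act G (k · σ) ρ (iterate F ρ k)
  Act-iterate F-Act zero    ρ = done (λ _ → refl) ≈-refl
  Act-iterate {F = F} F-Act (suc k) ρ = Act-⊕ (F-Act ρ) (Act-iterate F-Act k (F ρ))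

  Targets : Subset n
  Targets = Vec.tabulate T

  ∈Targets⁺ : ∀ {v} → T v ≡ true → v ∈ Targets
  ∈Targets⁺ {v} tv = lookup⇒[]= v Targets (trans (lookup∘tabulate T v) tv)

  ∈Targets⁻ : ∀ {v} → v ∈ Targets → T v ≡ true
  ∈Targets⁻ {v} v∈T = trans (sym (lookup∘tabulate T v)) ([]=⇒lookup v∈T)

  data Walk (S : Subset n) : Fin n → RConf G → Fin n → RConf G → Set where
    stop : ∀ {v ρ} → v ∈ S → Walk S v ρ v ρ
    move : ∀ {v ρ e ρ′} (p : T v ≡ false) → v ∉ S →
           Walk S (head v (newRotor G ρ (v , p))) (stepR G ρ (v , p)) e ρ′ → Walk S v ρ e ρ′

  WalkFrom : Subset n → Fin n → RConf G → Set
  WalkFrom S v ρ = ∃₂ λ e ρ′ → Walk S v ρ e ρ′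

  Walk-end : ∀ {S v e} → Walk S v ρ e ρ′ → e ∈ S
  Walk-end (stop e∈S)   = e∈S
  Walk-end (move _ _ W) = Walk-end W

  Walk-++ : ∀ {S S′ v e f} → S ⊆ S′ → Walk S′ v ρ e ρ′ → Walk S e ρ′ f a → Walk S v ρ f a
  Walk-++ S⊆S′ (stop _)         W′ = W′
  Walk-++ S⊆S′ (move p v∉S′ W) W′ = move p (λ v∈S → v∉S′ (S⊆S′ v∈S)) (Walk-++ S⊆S′ W W′)

  Walk-keeps : ∀ {S v e} → Walk S v ρ e ρ′ → (y : V₀ G) → proj₁ y ∈ S → ρ y ≡ ρ′ y
  Walk-keeps (stop _) y _ = refl
  Walk-keeps {ρ} {S = S} {v} (move p v∉S W) y y∈S =
    trans (sym (upd-≢ ρ (v , p) _ y (λ y≡v → v∉S (subst (_∈ S) (cong proj₁ y≡v) y∈S)))) (Walk-keeps W y y∈S)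

  Walk-Act : ∀ {v e} → Walk Targets v ρ e ρ′ → Act G (δ G v) ρ ρ′
  Walk-Act (stop v∈T) = done (δ-target (∈Targets⁻ v∈T)) ≈-refl
  Walk-Act {ρ} {v = v} (move p _ W) =
    step (v , p) (≤-reflexive (sym (δ-self (v , p))))
      (Act-resp (Walk-Act W) (λ y → sym (cong (_+ δ G (head v (newRotor G ρ (v , p))) y) (n∸n≡0 (δ G v y))))
        ≈-refl ≈-refl)

  exit-arc : ∀ {S v t} → Reach G v t → v ∉ S → t ∈ S → ∃₂ λ w (i : Fin (d w)) → w ∉ S × head w i ∈ S
  exit-arc here v∉S t∈S = contradiction t∈S v∉S
  exit-arc {S} {v} (there i r) v∉S t∈S with head v i ∈? S
  ... | yes vi∈S = v , i , v∉S , vi∈S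
  ... | no  vi∉S = exit-arc r vi∉S t∈S

  -- The rotor at w advances by one on each return of the particle to w, so it
  -- eventually points along the arc i leaving S ∪ {w} into S.
  module ViaExit {S : Subset n} {w : Fin n} {i : Fin (d w)} (Targets⊆S : Targets ⊆ S)
                 (w∉S : w ∉ S) (wi∈S : head w i ∈ S) (walk′ : ∀ v ρ → WalkFrom (S ∪ ⁅ w ⁆) v ρ) where

    x : V₀ G
    x = w , Bool.¬-not (λ tw → w∉S (Targets⊆S (∈Targets⁺ tw)))

    continue : ∀ {v e} → Walk (S ∪ ⁅ w ⁆) v ρ e ρ′ → WalkFrom S w ρ′ → WalkFrom S v ρ
    continue W rest with x∈p∪q⁻ S ⁅ w ⁆ (Walk-end W)
    ... | inj₁ e∈S  = _ , _ , Walk-++ (p⊆p∪q ⁅ w ⁆) W (stop e∈S)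
    ... | inj₂ e∈⁅w⁆ with x∈⁅y⁆⇒x≡y w e∈⁅w⁆
    ...   | refl = let f , ρ″ , W′ = rest in f , ρ″ , Walk-++ (p⊆p∪q ⁅ w ⁆) W W′

    from-w : ∀ j ρ → rotate j (newRotor G ρ x) ≡ i → WalkFrom S w ρ
    from-w zero ρ hits = _ , _ , move (proj₂ x) w∉S (stop (subst (λ l → head w l ∈ S) (sym hits) wi∈S))
    from-w (suc j) ρ hits =
      let e , ρ₁ , W = walk′ (head w (newRotor G ρ x)) (stepR G ρ x)
          rotor-kept : ρ₁ x ≡ newRotor G ρ x
          rotor-kept = trans (sym (Walk-keeps W x (q⊆p∪q S ⁅ w ⁆ (x∈⁅x⁆ w)))) (upd-≡ ρ x _)
          f , ρ″ , W′ = continue W (from-w j ρ₁ (trans (cong (rotate j ∘ sucMod) rotor-kept) hits))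
      in f , ρ″ , move (proj₂ x) w∉S W′

    walk-via-exit : ∀ v ρ → WalkFrom S v ρ
    walk-via-exit v ρ =
      let e , ρ₁ , W = walk′ v ρ
          j , hits = rotate-surjective (newRotor G ρ₁ x) i
      in continue W (from-w j ρ₁ hits)

  open ViaExit using (walk-via-exit)

  -- Target vertices carry no rotor and get the dummy coordinate zero.
  slot : RConf G → (u : Fin n) (b : Bool) → T u ≡ b → Fin (suc (d u))
  slot ρ u true  _ = zero
  slot ρ u false p = suc (ρ (u , p))

  coordinate : RConf G → (u : Fin n) → Fin (suc (d u))
  coordinate ρ u = slot ρ u (T u) refl

  coordinate-V₀ : (ρ : RConf G) (y : V₀ G) → coordinate ρ (proj₁ y) ≡ suc (ρ y)
  coordinate-V₀ ρ (u , p) = slot-V₀ (T u) refl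
    where
    slot-V₀ : ∀ b (q : T u ≡ b) → slot ρ u b q ≡ suc (ρ (u , p))
    slot-V₀ true  q = contradiction (trans (sym p) q) λ ()
    slot-V₀ false q = cong (λ q′ → suc (ρ (u , q′))) (V₀-irrelevant q p)

  encode : (L : List (Fin n)) → RConf G → Fin (product (map (suc ∘ d) L))
  encode []      ρ = zero
  encode (u ∷ L) ρ = combine (coordinate ρ u) (encode L ρ)

  encode-injective : (L : List (Fin n)) → encode L ρ ≡ encode L ρ′ → ∀ y → proj₁ y ∈ₗ L → ρ y ≡ ρ′ y
  encode-injective {ρ} {ρ′} (u ∷ L) same y (here refl) =
    suc-injective (trans (sym (coordinate-V₀ ρ y))
                    (trans (combine-injectiveˡ _ _ _ _ same) (coordinate-V₀ ρ′ y)))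
  encode-injective {ρ} {ρ′} (u ∷ L) same y (there y∈L) =
    encode-injective L (combine-injectiveʳ (coordinate ρ u) _ (coordinate ρ′ u) _ same) y y∈L

  Supported : List (Fin n) → PConf G → Set
  Supported L σ = ∀ y → proj₁ y ∉ₗ L → σ y ≡ 0

  Supported-drop : ∀ {w L} → Supported (w ∷ L) σ → (∀ y → proj₁ y ≡ w → σ y ≡ 0) → Supported L σ
  Supported-drop {w = w} supp empty-at-w y y∉L with proj₁ y ≟ w
  ... | yes y≡w = empty-at-w y y≡w
  ... | no  y≢w = supp y λ { (here y≡w) → y≢w y≡w ; (there y∈L) → y∉L y∈L }

  ≈⇒∼ : ρ ≈ᴳ ρ′ → ρ ∼ᴳ ρ′
  ≈⇒∼ {ρ} {ρ′} ρ≈ρ′ = (λ _ → 0) , ρ , ρ′ , done (λ _ → refl) ≈-refl , done (λ _ → refl) ≈-refl , ρ≈ρ′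

  module Termination (sc : StronglyConnected G) (tgt : NonemptyTargets G) where

    walk : (S : Subset n) → Acc _⊃_ S → Targets ⊆ S → ∀ v ρ → WalkFrom S v ρ
    walk S (acc rs) Targets⊆S v ρ with v ∈? S
    ... | yes v∈S = v , ρ , stop v∈S
    ... | no  v∉S with exit-arc (sc v (proj₁ tgt)) v∉S (Targets⊆S (∈Targets⁺ (proj₂ tgt)))
    ...   | w , i , w∉S , wi∈S =
      walk-via-exit Targets⊆S w∉S wi∈S
        (walk (S ∪ ⁅ w ⁆) (rs (p⊆p∪q ⁅ w ⁆ , w , q⊆p∪q S ⁅ w ⁆ (x∈⁅x⁆ w) , w∉S))
              (λ t∈T → p⊆p∪q ⁅ w ⁆ (Targets⊆S t∈T)))
        v ρ

    walk-to-targets : ∀ v ρ → WalkFrom Targets v ρ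
    walk-to-targets = walk Targets (⊃-wellFounded Targets) id

    Act-exists-supported : ∀ L σ ρ → Supported L σ → ∃ (Act G σ ρ)
    Act-exists-supported []      σ ρ supp = ρ , done (λ y → supp y λ ()) ≈-refl
    Act-exists-supported (w ∷ L) σ ρ supp with T w in tw
    ... | true  = Act-exists-supported L σ ρ
                    (Supported-drop supp λ y y≡w → contradiction y≡w (V₀-≢-target tw y))
    ... | false = emptying (σ (w , tw)) σ refl supp ρ
      where
      emptying : ∀ k σ → σ (w , tw) ≡ k → Supported (w ∷ L) σ → ∀ ρ → ∃ (Act G σ ρ)
      emptying zero σ empty supp ρ =
        Act-exists-supported L σ ρ (Supported-drop supp λ y y≡w → trans (cong σ (≡-fromVertex y≡w)) empty)
      emptying (suc k) σ σw≡1+k supp ρ =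
        let e , ρ₁ , W = walk-to-targets w ρ
            occupied : 1 ≤ σ (w , tw)
            occupied = subst (1 ≤_) (sym σw≡1+k) (s≤s z≤n)
            b , D = emptying k (λ y → σ y ∸ δ G w y) (cong₂ _∸_ σw≡1+k (δ-self (w , tw)))
                      (λ y y∉ → trans (cong (_∸ δ G w y) (supp y y∉)) (0∸n≡0 (δ G w y))) ρ₁
        in b , Act-resp (Act-⊕ (Walk-Act W) D) (λ y → m+[n∸m]≡n (δ≤occupied (w , tw) occupied y)) ≈-refl ≈-refl

    Act-exists : ∀ σ ρ → ∃ (Act G σ ρ)
    Act-exists σ ρ = Act-exists-supported (allFin n) σ ρ (λ y y∉ → contradiction (∈-allFin (proj₁ y)) y∉)

    act : PConf G → RConf G → RConf G
    act σ ρ = proj₁ (Act-exists σ ρ)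

    act-Act : ∀ σ ρ → Act G σ ρ (act σ ρ)
    act-Act σ ρ = proj₂ (Act-exists σ ρ)

    act-cong : ∀ σ → ρ ≈ᴳ ρ′ → act σ ρ ≈ᴳ act σ ρ′
    act-cong {ρ} {ρ′} σ ρ≈ρ′ = Act-deterministic (Act-resp (act-Act σ ρ) (λ _ → refl) ρ≈ρ′ ≈-refl) (act-Act σ ρ′)

    act-resp-∼ : ∀ σ ρ ρ′ → ρ ∼ᴳ ρ′ → act σ ρ ∼ᴳ act σ ρ′
    act-resp-∼ σ ρ ρ′ (ω , ρ₁ , ρ₂ , D₁ , D₂ , ρ₁≈ρ₂) =
      ω , act ω (act σ ρ) , act ω (act σ ρ′) , act-Act ω _ , act-Act ω _ ,
      ≈-trans (Act-swap (act-Act σ ρ) (act-Act ω _) D₁ (act-Act σ ρ₁))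
        (≈-trans (act-cong σ ρ₁≈ρ₂) (≈-sym (Act-swap (act-Act σ ρ′) (act-Act ω _) D₂ (act-Act σ ρ₂))))

    act-reflects-∼ : ∀ σ ρ ρ′ → act σ ρ ∼ᴳ act σ ρ′ → ρ ∼ᴳ ρ′
    act-reflects-∼ σ ρ ρ′ (ω , ρ₁ , ρ₂ , D₁ , D₂ , ρ₁≈ρ₂) =
      _⊕_ G σ ω , ρ₁ , ρ₂ , Act-⊕ (act-Act σ ρ) D₁ , Act-⊕ (act-Act σ ρ′) D₂ , ρ₁≈ρ₂

    -- By pigeonhole, act σ ^ m (act σ (act σ ^ k ρ′)) ≈ act σ ^ m ρ′, so m · σ witnesses the equivalence.
    act-surjective : ∀ σ ρ′ → ∃ λ ρ → act σ ρ ∼ᴳ ρ′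
    act-surjective σ ρ′ =
      let m , k , coincide = iterate-pigeonhole (act σ) (encode (allFin n)) ρ′
      in iterate (act σ) ρ′ k , m · σ , _ , _ , Act-iterate (act-Act σ) m _ , Act-iterate (act-Act σ) m ρ′ ,
         λ y → encode-injective (allFin n) coincide y (∈-allFin (proj₁ y))

corollary3p5 :
  (G : RotorGraph) → StronglyConnected G → NonemptyTargets G →
  ((σ : PConf G) → Σ (RConf G → RConf G) λ F →
      (∀ ρ → Act G σ ρ (F ρ))
    × (∀ ρ ρ' → _∼_ G ρ ρ' → _∼_ G (F ρ) (F ρ'))
    × (∀ ρ ρ' → _∼_ G (F ρ) (F ρ') → _∼_ G ρ ρ')
    × (∀ ρ' → ∃ λ ρ → _∼_ G (F ρ) ρ'))
  × (∀ τ₁ τ₂ τ₁₂ → Recurrent G τ₁ → Recurrent G τ₂ →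
      Stab G (_⊕_ G τ₁ τ₂) τ₁₂ →
      ∀ ρ ρ₂ ρ' ρ₁₂ → Act G τ₂ ρ ρ₂ → Act G τ₁ ρ₂ ρ' →
      Act G τ₁₂ ρ ρ₁₂ → _∼_ G ρ₁₂ ρ')
  × (∀ e → Recurrent G e →
      (∀ τ → Recurrent G τ → Stab G (_⊕_ G e τ) τ) →
      ∀ ρ ρ' → Act G e ρ ρ' → _∼_ G ρ' ρ)
corollary3p5 G sc tgt =
    (λ σ → act σ , act-Act σ , act-resp-∼ σ , act-reflects-∼ σ , act-surjective σ)
  , (λ τ₁ τ₂ τ₁₂ _ _ S ρ ρ₂ ρ′ ρ₁₂ D₂ D₁ D₁₂ → ≈⇒∼ (Act-⊕-stabilise S D₂ D₁ D₁₂))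
  , (λ e e-recurrent e-neutral ρ ρ′ D →
       let b , E = Act-exists e ρ′
       in e , b , ρ′ , E , D , Act-idempotent (e-neutral e e-recurrent) D E)
  where
  open RotorDynamics G
  open Termination sc tgt
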